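{- Let $n \ge 1$ be an integer. There exists a balanced Steinhaus triangle of side length $n$ in $\mathbb{Z}/4\mathbb{Z}$ if and only if $\binom{n+1}{2} \equiv 0 \pmod 4$ (equivalently, $n \equiv 0$ or $7 \pmod 8$). More precisely, consider the following infinite, eventually periodic sequences in $\mathbb{Z}/4\mathbb{Z}$: $$ \begin{array}{l} S_1 = 01220232(212113220030232311200232)^{\infty},\\ S_2 = 21210130(200132022112002110220130)^{\infty},\\ T_1 = 0120021(212202102023032200322021)^{\infty},\\ T_2 = 1000212(312223301210312003103232)^{\infty},\\ T_3 = 1200210(220101222032222103000210)^{\infty},\\ T_4 = 2102203(232002102021230022302203)^{\infty}. \end{array} $$ Then, for all integers $i,j,k$ with $1 \le i \le 2$, $1 \le j \le 4$ and $k \ge 0$, the Steinhaus triangles $\nabla S_i[8k]$ and $\nabla T_j[8k+7]$ are strongly balanced.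
   Context: For a finite sequence $S=(x_{1,1},\dots,x_{1,n})$ in $\mathbb{Z}/m\mathbb{Z}$, the Steinhaus triangle $\nabla S$ is the triangular array $(x_{i,j})_{1\le i\le n,\,1\le j\le n+1-i}$ defined by Pascal's rule $x_{i+1,j}=x_{i,j}+x_{i,j+1}$ (mod $m$); it has side length $n$ and $\binom{n+1}{2}$ entries. It is called balanced if every element of $\mathbb{Z}/m\mathbb{Z}$ occurs in it with the same multiplicity. For a finite or infinite sequence $S=(x_i)_{i\ge1}$ and an integer $0\le l\le$ length of $S$, $S[l]=(x_1,\dots,x_l)$ denotes its initial segment of length $l$. A Steinhaus triangle $\nabla S$ in $\mathbb{Z}/4\mathbb{Z}$ with $S$ of length $n$ is strongly balanced if $\nabla S[n-8t]$ is balanced for every integer $0 \le t \le n/8$ (the empty triangle counts as balanced). In the sequences listed, digits are elements of $\mathbb{Z}/4\mathbb{Z}$ and $(W)^\infty$ denotes infinite repetition of the word $W$ after the initial word. -}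

module Defs where

open import Data.Nat using (ℕ; zero; suc; _+_; _*_; _∸_; _<ᵇ_)
open import Data.Nat.DivMod using (_mod_; _%_)
open import Data.Fin using (Fin; toℕ)
open import Data.Fin.Properties using (_≟_)
open import Data.List using (List; []; _∷_; _++_; length; take)
open import Relation.Nullary using (yes; no)
open import Data.Bool using (if_then_else_)
open import Relation.Binary.PropositionalEquality using (_≡_)

Z4 : Set
Z4 = Fin 4

_⊕_ : Z4 → Z4 → Z4
a ⊕ b = (toℕ a + toℕ b) mod 4

derive : List Z4 → List Z4
derive []           = []
derive (x ∷ [])     = []
derive (x ∷ y ∷ xs) = (x ⊕ y) ∷ derive (y ∷ xs)

rowsFrom : ℕ → List Z4 → List Z4
rowsFrom zero    xs = []
rowsFrom (suc f) xs = xs ++ rowsFrom f (derive xs)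

-- the multiset of entries of the Steinhaus triangle ∇S (as a list)
steinhaus : List Z4 → List Z4
steinhaus xs = rowsFrom (length xs) xs

mult : Z4 → List Z4 → ℕ
mult a []       = 0
mult a (x ∷ xs) with x ≟ a
... | yes _ = suc (mult a xs)
... | no  _ = mult a xs

Balanced : List Z4 → Set
Balanced S = ∀ (a b : Z4) → mult a (steinhaus S) ≡ mult b (steinhaus S)

StronglyBalanced : List Z4 → Set
StronglyBalanced S = ∀ (t : ℕ) → 8 * t Data.Nat.≤ length S → Balanced (take (length S ∸ 8 * t) S)

-- infinite sequences in ℤ/4ℤ, 0-indexed (x₁ is position 0)
Seq : Set
Seq = ℕ → Z4

lookupℕ : List ℕ → ℕ → ℕ
lookupℕ []       i       = 0
lookupℕ (x ∷ xs) zero    = x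
lookupℕ (x ∷ xs) (suc i) = lookupℕ xs i

eventuallyPeriodic : List ℕ → List ℕ → Seq
eventuallyPeriodic pre per i =
  if i <ᵇ length pre
  then lookupℕ pre i mod 4
  else lookupℕ per ((i ∸ length pre) % suc (length per ∸ 1)) mod 4

initSeg : Seq → ℕ → List Z4
initSeg s zero    = []
initSeg s (suc l) = initSeg s l ++ (s l ∷ [])

S₁ S₂ T₁ T₂ T₃ T₄ : Seq
S₁ = eventuallyPeriodic (0 ∷ 1 ∷ 2 ∷ 2 ∷ 0 ∷ 2 ∷ 3 ∷ 2 ∷ [])
  (2 ∷ 1 ∷ 2 ∷ 1 ∷ 1 ∷ 3 ∷ 2 ∷ 2 ∷ 0 ∷ 0 ∷ 3 ∷ 0 ∷ 2 ∷ 3 ∷ 2 ∷ 3 ∷ 1 ∷ 1 ∷ 2 ∷ 0 ∷ 0 ∷ 2 ∷ 3 ∷ 2 ∷ [])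
S₂ = eventuallyPeriodic (2 ∷ 1 ∷ 2 ∷ 1 ∷ 0 ∷ 1 ∷ 3 ∷ 0 ∷ [])
  (2 ∷ 0 ∷ 0 ∷ 1 ∷ 3 ∷ 2 ∷ 0 ∷ 2 ∷ 2 ∷ 1 ∷ 1 ∷ 2 ∷ 0 ∷ 0 ∷ 2 ∷ 1 ∷ 1 ∷ 0 ∷ 2 ∷ 2 ∷ 0 ∷ 1 ∷ 3 ∷ 0 ∷ [])
T₁ = eventuallyPeriodic (0 ∷ 1 ∷ 2 ∷ 0 ∷ 0 ∷ 2 ∷ 1 ∷ [])
  (2 ∷ 1 ∷ 2 ∷ 2 ∷ 0 ∷ 2 ∷ 1 ∷ 0 ∷ 2 ∷ 0 ∷ 2 ∷ 3 ∷ 0 ∷ 3 ∷ 2 ∷ 2 ∷ 0 ∷ 0 ∷ 3 ∷ 2 ∷ 2 ∷ 0 ∷ 2 ∷ 1 ∷ [])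
T₂ = eventuallyPeriodic (1 ∷ 0 ∷ 0 ∷ 0 ∷ 2 ∷ 1 ∷ 2 ∷ [])
  (3 ∷ 1 ∷ 2 ∷ 2 ∷ 2 ∷ 3 ∷ 3 ∷ 0 ∷ 1 ∷ 2 ∷ 1 ∷ 0 ∷ 3 ∷ 1 ∷ 2 ∷ 0 ∷ 0 ∷ 3 ∷ 1 ∷ 0 ∷ 3 ∷ 2 ∷ 3 ∷ 2 ∷ [])
T₃ = eventuallyPeriodic (1 ∷ 2 ∷ 0 ∷ 0 ∷ 2 ∷ 1 ∷ 0 ∷ [])
  (2 ∷ 2 ∷ 0 ∷ 1 ∷ 0 ∷ 1 ∷ 2 ∷ 2 ∷ 2 ∷ 0 ∷ 3 ∷ 2 ∷ 2 ∷ 2 ∷ 2 ∷ 1 ∷ 0 ∷ 3 ∷ 0 ∷ 0 ∷ 0 ∷ 2 ∷ 1 ∷ 0 ∷ [])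
T₄ = eventuallyPeriodic (2 ∷ 1 ∷ 0 ∷ 2 ∷ 2 ∷ 0 ∷ 3 ∷ [])
  (2 ∷ 3 ∷ 2 ∷ 0 ∷ 0 ∷ 2 ∷ 1 ∷ 0 ∷ 2 ∷ 0 ∷ 2 ∷ 1 ∷ 2 ∷ 3 ∷ 0 ∷ 0 ∷ 2 ∷ 2 ∷ 3 ∷ 0 ∷ 2 ∷ 2 ∷ 0 ∷ 3 ∷ [])

-- Each value occurs equally often in ∇S only if 4 divides its size C(n+1,2), which among
-- the residues of n modulo 8 leaves exactly 0 and 7.
--
-- For the listed sequences s, which are 24-periodic from position 8 on, passing from
-- ∇s[p+7] to ∇s[p+31] appends a window of 24 consecutive entries to each of the first p
-- rows (by periodicity each window has the value counts of one full period of its row)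
-- and replaces the bottom subtriangle of side 7 by the one of side 31. The rows of ∇s
-- are periodic as well (row 30 equals row 6), so the value counts of this increment
-- depend on p only through p mod 24 once p ≥ 6. Balancedness of every ∇s[8k+r] thus
-- follows by induction from finitely many cases, which are settled by evaluation.
module Submission where

open import Defs
open import Data.Bool using (true; false; T)
open import Data.Fin using (Fin; zero; suc)
open import Data.Fin.Properties using (_≟_)
open import Data.List using (List; []; _∷_; _++_; length; take; drop)
open import Data.List.Properties using (∷-injective; length-++; take-all; ≡-dec)
open import Data.Nat using (ℕ; zero; suc; _+_; _*_; _∸_; _≤_; _<_; _<ᵇ_; s≤s; z≤n; z<s)
open import Data.Nat.Combinatorics using (_C_; nC1≡n; nCk+nC[k+1]≡[n+1]C[k+1])
open import Data.Nat.DivMod using (_%_; _/_; _mod_; [m+n]%n≡m%n; [m+kn]%n≡m%n; m*n%n≡0; m≡m%n+[m/n]*n; m%n<n)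
open import Data.Nat.Induction using (<-rec)
open import Data.Nat.Properties hiding (_≟_)
open import Data.Nat.Tactic.RingSolver using (solve-∀)
open import Data.Product using (Σ; _×_; _,_; proj₁; proj₂)
open import Data.Sum using (_⊎_; inj₁; inj₂)
open import Data.Unit using (tt)
open import Data.Vec using (tabulate; lookup)
open import Data.Vec.Properties using (lookup∘tabulate)
open import Function using (_∘_)
open import Function.Bundles using (_⇔_; mk⇔)
open import Relation.Nullary using (yes; no; contradiction)
open import Relation.Nullary.Decidable using (True; toWitness)
open import Relation.Binary.PropositionalEquality

prefix : Seq → ℕ → List Z4
prefix f zero    = []
prefix f (suc m) = f 0 ∷ prefix (f ∘ suc) m

prefix-snoc : ∀ f m → prefix f (suc m) ≡ prefix f m ++ (f m ∷ [])
prefix-snoc f zero    = refl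
prefix-snoc f (suc m) = cong (f 0 ∷_) (prefix-snoc (f ∘ suc) m)

initSeg≡prefix : ∀ f m → initSeg f m ≡ prefix f m
initSeg≡prefix f zero    = refl
initSeg≡prefix f (suc m) = trans (cong (_++ (f m ∷ [])) (initSeg≡prefix f m)) (sym (prefix-snoc f m))

length-prefix : ∀ f m → length (prefix f m) ≡ m
length-prefix f zero    = refl
length-prefix f (suc m) = cong suc (length-prefix (f ∘ suc) m)

length-initSeg : ∀ f n → length (initSeg f n) ≡ n
length-initSeg f n = trans (cong length (initSeg≡prefix f n)) (length-prefix f n)

take-prefix : ∀ f {m n} → m ≤ n → take m (prefix f n) ≡ prefix f m
take-prefix f {zero}          _         = refl
take-prefix f {suc m} {suc n} (s≤s m≤n) = cong (f 0 ∷_) (take-prefix (f ∘ suc) m≤n)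

prefix-+ : ∀ f m k → prefix f (m + k) ≡ prefix f m ++ prefix (f ∘ (m +_)) k
prefix-+ f zero    k = refl
prefix-+ f (suc m) k = cong (f 0 ∷_) (prefix-+ (f ∘ suc) m k)

prefix-cong : ∀ {f g} → f ≗ g → ∀ m → prefix f m ≡ prefix g m
prefix-cong f≗g zero    = refl
prefix-cong f≗g (suc m) = cong₂ _∷_ (f≗g 0) (prefix-cong (f≗g ∘ suc) m)

prefix-injective : ∀ {f g} m → prefix f m ≡ prefix g m → ∀ {j} → j < m → f j ≡ g j
prefix-injective (suc m) eq {zero}  _         = proj₁ (∷-injective eq)
prefix-injective (suc m) eq {suc j} (s≤s j<m) = prefix-injective m (proj₂ (∷-injective eq)) j<m

mult-++ : ∀ a xs ys → mult a (xs ++ ys) ≡ mult a xs + mult a ys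
mult-++ a []       ys = refl
mult-++ a (x ∷ xs) ys with x ≟ a
... | yes _ = cong suc (mult-++ a xs ys)
... | no  _ = mult-++ a xs ys

mult-snoc : ∀ a xs x → mult a (xs ++ (x ∷ [])) ≡ mult a (x ∷ xs)
mult-snoc a xs x = trans (mult-++ a xs (x ∷ [])) (trans (+-comm (mult a xs) _) (mult-singleton-+ x))
  where
  mult-singleton-+ : ∀ x → mult a (x ∷ []) + mult a xs ≡ mult a (x ∷ xs)
  mult-singleton-+ x with x ≟ a
  ... | yes _ = refl
  ... | no  _ = refl

mult-total : ∀ xs → mult zero xs + mult (suc zero) xs + mult (suc (suc zero)) xs + mult (suc (suc (suc zero))) xs ≡ length xs
mult-total []                          = refl
mult-total (zero ∷ xs)                 = cong suc (mult-total xs)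
mult-total (suc zero ∷ xs)             = trans (suc-second (mult zero xs) _ _ _) (cong suc (mult-total xs))
  where
  suc-second : ∀ a b c d → a + suc b + c + d ≡ suc (a + b + c + d)
  suc-second = solve-∀
mult-total (suc (suc zero) ∷ xs)       = trans (suc-third (mult zero xs) _ _ _) (cong suc (mult-total xs))
  where
  suc-third : ∀ a b c d → a + b + suc c + d ≡ suc (a + b + c + d)
  suc-third = solve-∀
mult-total (suc (suc (suc zero)) ∷ xs) = trans (+-suc (mult zero xs + _ + _) _) (cong suc (mult-total xs))

Uniform : {A : Set} → (A → ℕ) → Set
Uniform u = ∀ a b → u a ≡ u b

ConstantDifference : {A : Set} → (A → ℕ) → (A → ℕ) → Set
ConstantDifference u v = ∀ a b → u a + v b ≡ u b + v a

module _ {A : Set} where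

  uniform-via : ∀ {u : A → ℕ} a₀ → (∀ a → u a ≡ u a₀) → Uniform u
  uniform-via a₀ to-a₀ a b = trans (to-a₀ a) (sym (to-a₀ b))

  constantDifference-via : ∀ {u v : A → ℕ} a₀ → (∀ a → u a + v a₀ ≡ u a₀ + v a) → ConstantDifference u v
  constantDifference-via {u} {v} a₀ to-a₀ a b = +-cancelʳ-≡ (v a₀) _ _ (begin
    u a + v b + v a₀    ≡⟨ swap (u a) (v b) (v a₀) ⟩
    u a + v a₀ + v b    ≡⟨ cong (_+ v b) (to-a₀ a) ⟩
    u a₀ + v a + v b    ≡⟨ swap (u a₀) (v a) (v b) ⟩
    u a₀ + v b + v a    ≡⟨ cong (_+ v a) (sym (to-a₀ b)) ⟩
    u b + v a₀ + v a    ≡⟨ swap (u b) (v a₀) (v a) ⟩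
    u b + v a + v a₀    ∎)
    where
    open ≡-Reasoning
    swap : ∀ x y z → x + y + z ≡ x + z + y
    swap = solve-∀

  uniform-transfer : ∀ {x y u v : A → ℕ} → (∀ a → x a + v a ≡ y a + u a) →
                     Uniform y → ConstantDifference u v → Uniform x
  uniform-transfer {x} {y} {u} {v} split y-uniform uv-constant a b = +-cancelʳ-≡ (v a + v b) _ _ (begin
    x a + (v a + v b)     ≡⟨ sym (+-assoc (x a) (v a) (v b)) ⟩
    x a + v a + v b       ≡⟨ cong (_+ v b) (split a) ⟩
    y a + u a + v b       ≡⟨ +-assoc (y a) (u a) (v b) ⟩
    y a + (u a + v b)     ≡⟨ cong₂ _+_ (y-uniform a b) (uv-constant a b) ⟩
    y b + (u b + v a)     ≡⟨ sym (+-assoc (y b) (u b) (v a)) ⟩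
    y b + u b + v a       ≡⟨ cong (_+ v a) (sym (split b)) ⟩
    x b + v b + v a       ≡⟨ +-assoc (x b) (v b) (v a) ⟩
    x b + (v b + v a)     ≡⟨ cong (x b +_) (+-comm (v b) (v a)) ⟩
    x b + (v a + v b)     ∎)
    where open ≡-Reasoning

  constantDifference-extend : ∀ {u u′ v v′ k : A → ℕ} → (∀ a → u′ a ≡ u a + k a) → (∀ a → v′ a ≡ v a) →
                              Uniform k → ConstantDifference u v → ConstantDifference u′ v′
  constantDifference-extend {u} {u′} {v} {v′} {k} u′≡ v′≡ k-uniform uv-constant a b = begin
    u′ a + v′ b           ≡⟨ cong₂ _+_ (u′≡ a) (v′≡ b) ⟩
    u a + k a + v b       ≡⟨ swap (u a) (k a) (v b) ⟩
    u a + v b + k a       ≡⟨ cong₂ _+_ (uv-constant a b) (k-uniform a b) ⟩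
    u b + v a + k b       ≡⟨ swap (u b) (v a) (k b) ⟩
    u b + k b + v a       ≡⟨ sym (cong₂ _+_ (u′≡ b) (v′≡ a)) ⟩
    u′ b + v′ a           ∎
    where
    open ≡-Reasoning
    swap : ∀ x y z → x + y + z ≡ x + z + y
    swap = solve-∀

tabulate-injective : ∀ {n} {A : Set} (f g : Fin n → A) → tabulate f ≡ tabulate g → f ≗ g
tabulate-injective f g eq i =
  trans (sym (lookup∘tabulate f i)) (trans (cong (λ v → lookup v i) eq) (lookup∘tabulate g i))

stride₃-induction : (P : ℕ → Set) → P 0 → P 1 → P 2 → (∀ k → P k → P (3 + k)) → ∀ k → P k
stride₃-induction P p₀ p₁ p₂ step zero                = p₀
stride₃-induction P p₀ p₁ p₂ step (suc zero)          = p₁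
stride₃-induction P p₀ p₁ p₂ step (suc (suc zero))    = p₂
stride₃-induction P p₀ p₁ p₂ step (suc (suc (suc k))) = step k (stride₃-induction P p₀ p₁ p₂ step k)

[8k+r]∸8t≡8[k∸t]+r : ∀ k t r → r < 8 → 8 * t ≤ 8 * k + r → 8 * k + r ∸ 8 * t ≡ 8 * (k ∸ t) + r
[8k+r]∸8t≡8[k∸t]+r k       zero    r r<8 _  = refl
[8k+r]∸8t≡8[k∸t]+r zero    (suc t) r r<8 le =
  contradiction r<8 (≤⇒≯ (≤-trans (m≤m+n 8 (8 * t)) (subst (_≤ r) (*-suc 8 t) le)))
[8k+r]∸8t≡8[k∸t]+r (suc k) (suc t) r r<8 le = begin
  8 * suc k + r ∸ 8 * suc t       ≡⟨ cong₂ _∸_ (shift k r) (*-suc 8 t) ⟩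
  8 + (8 * k + r) ∸ (8 + 8 * t)   ≡⟨ [m+n]∸[m+o]≡n∸o 8 (8 * k + r) (8 * t) ⟩
  8 * k + r ∸ 8 * t               ≡⟨ [8k+r]∸8t≡8[k∸t]+r k t r r<8 8t≤8k+r ⟩
  8 * (k ∸ t) + r                 ∎
  where
  open ≡-Reasoning
  shift : ∀ k r → 8 * suc k + r ≡ 8 + (8 * k + r)
  shift = solve-∀
  8t≤8k+r : 8 * t ≤ 8 * k + r
  8t≤8k+r = +-cancelˡ-≤ 8 _ _ (subst₂ _≤_ (*-suc 8 t) (shift k r) le)

<ᵇ-false : ∀ {m n} → n ≤ m → (m <ᵇ n) ≡ false
<ᵇ-false {m} {n} n≤m with m <ᵇ n in eq
... | false = refl
... | true  = contradiction (<ᵇ⇒< m n (subst T (sym eq) tt)) (≤⇒≯ n≤m)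

-- The size of a Steinhaus triangle

C2-suc : ∀ n → suc (suc n) C 2 ≡ suc n + suc n C 2
C2-suc n = trans (sym (nCk+nC[k+1]≡[n+1]C[k+1] (suc n) 1)) (cong (_+ suc n C 2) (nC1≡n (suc n)))

length-derive : ∀ n xs → length xs ≡ suc n → length (derive xs) ≡ n
length-derive zero    (x ∷ [])     refl = refl
length-derive (suc n) (x ∷ y ∷ xs) len  = cong suc (length-derive n (y ∷ xs) (suc-injective len))

length-rowsFrom : ∀ n xs → length xs ≡ n → length (rowsFrom n xs) ≡ suc n C 2
length-rowsFrom zero    xs len = refl
length-rowsFrom (suc n) xs len = begin
  length (xs ++ rowsFrom n (derive xs))       ≡⟨ length-++ xs ⟩
  length xs + length (rowsFrom n (derive xs)) ≡⟨ cong₂ _+_ len (length-rowsFrom n (derive xs) (length-derive n xs len)) ⟩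
  suc n + suc n C 2                           ≡⟨ sym (C2-suc n) ⟩
  suc (suc n) C 2                             ∎
  where open ≡-Reasoning

balanced⇒C2%4≡0 : ∀ xs → Balanced xs → (suc (length xs) C 2) % 4 ≡ 0
balanced⇒C2%4≡0 xs balanced = subst (λ m → m % 4 ≡ 0) four-equal-parts (m*n%n≡0 (mult zero ∇) 4)
  where
  ∇ = steinhaus xs
  four-equal-parts : mult zero ∇ * 4 ≡ suc (length xs) C 2
  four-equal-parts = begin
    mult zero ∇ * 4
      ≡⟨ times4 (mult zero ∇) ⟩
    mult zero ∇ + mult zero ∇ + mult zero ∇ + mult zero ∇
      ≡⟨ cong₂ _+_ (cong₂ _+_ (cong (mult zero ∇ +_) (balanced zero (suc zero))) (balanced zero (suc (suc zero))))
                   (balanced zero (suc (suc (suc zero)))) ⟩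
    mult zero ∇ + mult (suc zero) ∇ + mult (suc (suc zero)) ∇ + mult (suc (suc (suc zero))) ∇
      ≡⟨ mult-total ∇ ⟩
    length ∇
      ≡⟨ length-rowsFrom (length xs) xs refl ⟩
    suc (length xs) C 2 ∎
    where
    open ≡-Reasoning
    times4 : ∀ x → x * 4 ≡ x + x + x + x
    times4 = solve-∀

2*C2 : ∀ n → 2 * (suc n C 2) ≡ n * suc n
2*C2 zero    = refl
2*C2 (suc n) = begin
  2 * (suc (suc n) C 2)       ≡⟨ cong (2 *_) (C2-suc n) ⟩
  2 * (suc n + suc n C 2)     ≡⟨ *-distribˡ-+ 2 (suc n) _ ⟩
  2 * suc n + 2 * (suc n C 2) ≡⟨ cong (2 * suc n +_) (2*C2 n) ⟩
  2 * suc n + n * suc n       ≡⟨ expand n ⟩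
  suc n * suc (suc n)         ∎
  where
  open ≡-Reasoning
  expand : ∀ n → 2 * suc n + n * suc n ≡ suc n * suc (suc n)
  expand = solve-∀

C2-+8q : ∀ r q → suc (r + q * 8) C 2 ≡ suc r C 2 + q * (2 * r + 1 + 8 * q) * 4
C2-+8q r q = *-cancelˡ-≡ _ _ 2 (begin
  2 * (suc (r + q * 8) C 2)                        ≡⟨ 2*C2 (r + q * 8) ⟩
  (r + q * 8) * suc (r + q * 8)                    ≡⟨ expand r q ⟩
  r * suc r + 2 * (q * (2 * r + 1 + 8 * q) * 4)    ≡⟨ cong (_+ 2 * (q * (2 * r + 1 + 8 * q) * 4)) (sym (2*C2 r)) ⟩
  2 * (suc r C 2) + 2 * (q * (2 * r + 1 + 8 * q) * 4) ≡⟨ sym (*-distribˡ-+ 2 (suc r C 2) _) ⟩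
  2 * (suc r C 2 + q * (2 * r + 1 + 8 * q) * 4)    ∎)
  where
  open ≡-Reasoning
  expand : ∀ r q → (r + q * 8) * suc (r + q * 8) ≡ r * suc r + 2 * (q * (2 * r + 1 + 8 * q) * 4)
  expand = solve-∀

C2%4≡0⇒residue : ∀ n → (suc n C 2) % 4 ≡ 0 → n % 8 ≡ 0 ⊎ n % 8 ≡ 7
C2%4≡0⇒residue n 4∣C2 = residues r (m%n<n n 8) (begin
  (suc r C 2) % 4                               ≡⟨ sym ([m+kn]%n≡m%n (suc r C 2) (q * (2 * r + 1 + 8 * q)) 4) ⟩
  (suc r C 2 + q * (2 * r + 1 + 8 * q) * 4) % 4 ≡⟨ cong (_% 4) (sym (C2-+8q r q)) ⟩
  (suc (r + q * 8) C 2) % 4                     ≡⟨ cong (λ m → (suc m C 2) % 4) (sym (m≡m%n+[m/n]*n n 8)) ⟩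
  (suc n C 2) % 4                               ≡⟨ 4∣C2 ⟩
  0                                             ∎)
  where
  open ≡-Reasoning
  r = n % 8
  q = n / 8
  residues : ∀ r → r < 8 → (suc r C 2) % 4 ≡ 0 → r ≡ 0 ⊎ r ≡ 7
  residues 0 _ _ = inj₁ refl
  residues 7 _ _ = inj₂ refl
  residues 1 _ ()
  residues 2 _ ()
  residues 3 _ ()
  residues 4 _ ()
  residues 5 _ ()
  residues 6 _ ()
  residues (suc (suc (suc (suc (suc (suc (suc (suc r)))))))) (s≤s (s≤s (s≤s (s≤s (s≤s (s≤s (s≤s (s≤s ())))))))) _

-- Derived sequences

Periodic₂₄ : Seq → Set
Periodic₂₄ g = ∀ j → g (24 + j) ≡ g j

PeriodicAfter8 : Seq → Set
PeriodicAfter8 f = Periodic₂₄ (f ∘ (8 +_))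

-- Δ and triangleCount are opaque: unfolding them during unification expands the entries
-- of deep rows into exponentially large sums.
opaque
  Δ : Seq → Seq
  Δ f j = f j ⊕ f (suc j)

  derive-prefix : ∀ f m → derive (prefix f (suc m)) ≡ prefix (Δ f) m
  derive-prefix f zero    = refl
  derive-prefix f (suc m) = cong (Δ f 0 ∷_) (derive-prefix (f ∘ suc) m)

  Δ-cong : ∀ {f g} → f ≗ g → Δ f ≗ Δ g
  Δ-cong f≗g j = cong₂ _⊕_ (f≗g j) (f≗g (suc j))

  PeriodicAfter8-Δ : ∀ f → PeriodicAfter8 f → PeriodicAfter8 (Δ f)
  PeriodicAfter8-Δ f per j = cong₂ _⊕_ (per j) (per (suc j))

Δⁿ : ℕ → Seq → Seq
Δⁿ zero    f = f
Δⁿ (suc p) f = Δⁿ p (Δ f)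

deriveⁿ : ℕ → List Z4 → List Z4
deriveⁿ zero    xs = xs
deriveⁿ (suc p) xs = deriveⁿ p (derive xs)

deriveⁿ-prefix : ∀ p f m → deriveⁿ p (prefix f (p + m)) ≡ prefix (Δⁿ p f) m
deriveⁿ-prefix zero    f m = refl
deriveⁿ-prefix (suc p) f m rewrite derive-prefix f (p + m) = deriveⁿ-prefix p (Δ f) m

Δⁿ-+ : ∀ p q f → Δⁿ (p + q) f ≡ Δⁿ q (Δⁿ p f)
Δⁿ-+ zero    q f = refl
Δⁿ-+ (suc p) q f = Δⁿ-+ p q (Δ f)

Δⁿ-suc : ∀ p f → Δⁿ (suc p) f ≡ Δ (Δⁿ p f)
Δⁿ-suc p f = trans (cong (λ i → Δⁿ i f) (+-comm 1 p)) (Δⁿ-+ p 1 f)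

PeriodicAfter8-Δⁿ : ∀ p f → PeriodicAfter8 f → PeriodicAfter8 (Δⁿ p f)
PeriodicAfter8-Δⁿ zero    f per = per
PeriodicAfter8-Δⁿ (suc p) f per = PeriodicAfter8-Δⁿ p (Δ f) (PeriodicAfter8-Δ f per)

PeriodicAfter8-≗ : ∀ {g h} → PeriodicAfter8 g → PeriodicAfter8 h → (∀ {j} → j < 32 → g j ≡ h j) → g ≗ h
PeriodicAfter8-≗ {g} {h} per-g per-h agree = <-rec (λ j → g j ≡ h j) step
  where
  step : ∀ j → (∀ {i} → i < j → g i ≡ h i) → g j ≡ h j
  step j earlier with j <? 32
  ... | yes j<32 = agree j<32
  ... | no  j≮32 = subst (λ i → g i ≡ h i) (m+[n∸m]≡n (≮⇒≥ j≮32))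
          (trans (per-g t) (trans (earlier′ (m<n+m (8 + t) {24} z<s)) (sym (per-h t))))
    where
    t = j ∸ 32
    earlier′ : 8 + t < 32 + t → g (8 + t) ≡ h (8 + t)
    earlier′ lt = earlier (subst (8 + t <_) (m+[n∸m]≡n (≮⇒≥ j≮32)) lt)

-- Stated for any s equal to eventuallyPeriodic pre per so that the two words are inferred
-- from the definition of s.
eventuallyPeriodic-periodicAfter8 : ∀ {pre per} s → s ≡ eventuallyPeriodic pre per →
                                    length pre ≤ 8 → length per ≡ 24 → PeriodicAfter8 s
eventuallyPeriodic-periodicAfter8 {pre} {per} s refl ℓ≤8 period j
  rewrite <ᵇ-false (≤-trans ℓ≤8 (m≤m+n 8 (24 + j))) | <ᵇ-false (≤-trans ℓ≤8 (m≤m+n 8 j)) | period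
  = cong (λ i → lookupℕ per i mod 4) (begin
      (24 + (8 + j) ∸ length pre) % 24 ≡⟨ cong (_% 24) (+-∸-assoc 24 (≤-trans ℓ≤8 (m≤m+n 8 j))) ⟩
      (24 + (8 + j ∸ length pre)) % 24 ≡⟨ cong (_% 24) (+-comm 24 (8 + j ∸ length pre)) ⟩
      (8 + j ∸ length pre + 24) % 24   ≡⟨ [m+n]%n≡m%n (8 + j ∸ length pre) 24 ⟩
      (8 + j ∸ length pre) % 24        ∎)
  where open ≡-Reasoning

-- Counting entries of ∇s[n]

count : Z4 → Seq → ℕ → ℕ
count a f m = mult a (prefix f m)

count-+ : ∀ a f m k → count a f (m + k) ≡ count a f m + count a (f ∘ (m +_)) k
count-+ a f m k = trans (cong (mult a) (prefix-+ f m k)) (mult-++ a (prefix f m) _)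

count-period-shift : ∀ a k {g} → Periodic₂₄ g → count a (g ∘ (k +_)) 24 ≡ count a g 24
count-period-shift a zero    per = refl
count-period-shift a (suc k) {g} per = trans (count-period-shift a k {g ∘ suc} (per ∘ suc)) rotate
  where
  open ≡-Reasoning
  rotate : count a (g ∘ suc) 24 ≡ count a g 24
  rotate = begin
    mult a (prefix (g ∘ suc) 24)             ≡⟨ cong (mult a) (prefix-snoc (g ∘ suc) 23) ⟩
    mult a (prefix (g ∘ suc) 23 ++ (g 24 ∷ [])) ≡⟨ mult-snoc a _ (g 24) ⟩
    mult a (g 24 ∷ prefix (g ∘ suc) 23)       ≡⟨ cong (λ x → mult a (x ∷ prefix (g ∘ suc) 23)) (per 0) ⟩
    mult a (prefix g 24)                      ∎

periodCount : Z4 → Seq → ℕ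
periodCount a f = count a (f ∘ (8 +_)) 24

periodCount-cong : ∀ a {f g} → f ≗ g → periodCount a f ≡ periodCount a g
periodCount-cong a f≗g = cong (mult a) (prefix-cong (f≗g ∘ (8 +_)) 24)

count-+24 : ∀ a {f} → PeriodicAfter8 f → ∀ q → count a f (8 + q + 24) ≡ count a f (8 + q) + periodCount a f
count-+24 a {f} per q = trans (count-+ a f (8 + q) 24) (cong (count a f (8 + q) +_) (count-period-shift a q {f ∘ (8 +_)} per))

opaque
  triangleCount : Z4 → Seq → ℕ → ℕ
  triangleCount a f n = mult a (rowsFrom n (prefix f n))

  triangleCount-suc : ∀ a f n → triangleCount a f (suc n) ≡ count a f (suc n) + triangleCount a (Δ f) n
  triangleCount-suc a f n rewrite derive-prefix f n = mult-++ a (prefix f (suc n)) _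

  triangleCount-cong : ∀ a {f g} → f ≗ g → ∀ n → triangleCount a f n ≡ triangleCount a g n
  triangleCount-cong a f≗g n = cong (mult a ∘ rowsFrom n) (prefix-cong f≗g n)

  triangleCount-eval : ∀ a p f m → triangleCount a (Δⁿ p f) m ≡ mult a (rowsFrom m (deriveⁿ p (prefix f (p + m))))
  triangleCount-eval a p f m = cong (mult a ∘ rowsFrom m) (sym (deriveⁿ-prefix p f m))

stripCount : Z4 → Seq → ℕ → ℕ
stripCount a f zero    = 0
stripCount a f (suc p) = periodCount a f + stripCount a (Δ f) p

stripCount-+ : ∀ a f p q → stripCount a f (p + q) ≡ stripCount a f p + stripCount a (Δⁿ p f) q
stripCount-+ a f zero    q = refl
stripCount-+ a f (suc p) q = trans (cong (periodCount a f +_) (stripCount-+ a (Δ f) p q)) (sym (+-assoc (periodCount a f) _ _))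

-- Row i < p of ∇f[p+31] is row i of ∇f[p+7] followed by 24 consecutive entries of Δⁱ f.
triangleCount-+24 : ∀ a p {f} → PeriodicAfter8 f →
  triangleCount a f (p + 31) + triangleCount a (Δⁿ p f) 7
    ≡ triangleCount a f (p + 7) + (stripCount a f p + triangleCount a (Δⁿ p f) 31)
triangleCount-+24 a zero {f} per = +-comm (triangleCount a f 31) _
triangleCount-+24 a (suc p) {f} per = begin
  triangleCount a f (suc (p + 31)) + N₇
    ≡⟨ cong (_+ N₇) (triangleCount-suc a f (p + 31)) ⟩
  count a f (suc (p + 31)) + triangleCount a (Δ f) (p + 31) + N₇
    ≡⟨ cong (λ x → x + triangleCount a (Δ f) (p + 31) + N₇) longer-row ⟩
  count a f (suc (p + 7)) + periodCount a f + triangleCount a (Δ f) (p + 31) + N₇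
    ≡⟨ regroup (count a f (suc (p + 7))) (periodCount a f) _ N₇ ⟩
  count a f (suc (p + 7)) + periodCount a f + (triangleCount a (Δ f) (p + 31) + N₇)
    ≡⟨ cong (count a f (suc (p + 7)) + periodCount a f +_) (triangleCount-+24 a p (PeriodicAfter8-Δ f per)) ⟩
  count a f (suc (p + 7)) + periodCount a f + (triangleCount a (Δ f) (p + 7) + (stripCount a (Δ f) p + N₃₁))
    ≡⟨ shuffle (count a f (suc (p + 7))) (periodCount a f) _ _ N₃₁ ⟩
  count a f (suc (p + 7)) + triangleCount a (Δ f) (p + 7) + (periodCount a f + stripCount a (Δ f) p + N₃₁)
    ≡⟨ cong (_+ (stripCount a f (suc p) + N₃₁)) (sym (triangleCount-suc a f (p + 7))) ⟩
  triangleCount a f (suc (p + 7)) + (stripCount a f (suc p) + N₃₁) ∎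
  where
  open ≡-Reasoning
  N₇ = triangleCount a (Δⁿ p (Δ f)) 7
  N₃₁ = triangleCount a (Δⁿ p (Δ f)) 31
  index₃₁ : ∀ p → suc (p + 31) ≡ 8 + p + 24
  index₃₁ = solve-∀
  index₇ : ∀ p → 8 + p ≡ suc (p + 7)
  index₇ = solve-∀
  longer-row : count a f (suc (p + 31)) ≡ count a f (suc (p + 7)) + periodCount a f
  longer-row = begin
    count a f (suc (p + 31))          ≡⟨ cong (count a f) (index₃₁ p) ⟩
    count a f (8 + p + 24)            ≡⟨ count-+24 a {f} per p ⟩
    count a f (8 + p) + periodCount a f ≡⟨ cong (λ i → count a f i + periodCount a f) (index₇ p) ⟩
    count a f (suc (p + 7)) + periodCount a f ∎
  regroup : ∀ x y z w → x + y + z + w ≡ x + y + (z + w)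
  regroup = solve-∀
  shuffle : ∀ x y z u v → x + y + (z + (u + v)) ≡ x + z + (y + u + v)
  shuffle = solve-∀

-- Periodic rows

RowPeriodic : Seq → Set
RowPeriodic g = Δⁿ 24 g ≗ g

RowPeriodic-Δ : ∀ g → RowPeriodic g → RowPeriodic (Δ g)
RowPeriodic-Δ g rows j = trans (cong-app (Δⁿ-suc 24 g) j) (Δ-cong rows j)

RowPeriodic-Δⁿ : ∀ q g → RowPeriodic g → RowPeriodic (Δⁿ q g)
RowPeriodic-Δⁿ zero    g rows = rows
RowPeriodic-Δⁿ (suc q) g rows = RowPeriodic-Δⁿ q (Δ g) (RowPeriodic-Δ g rows)

stripCount-rotate : ∀ a g → RowPeriodic g → stripCount a (Δ g) 24 ≡ stripCount a g 24
stripCount-rotate a g rows = begin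
  stripCount a (Δ g) (23 + 1)                        ≡⟨ stripCount-+ a (Δ g) 23 1 ⟩
  S₂₃ + (periodCount a (Δⁿ 24 g) + 0)                ≡⟨ cong (λ x → S₂₃ + (x + 0)) (periodCount-cong a rows) ⟩
  S₂₃ + (periodCount a g + 0)                        ≡⟨ cong (S₂₃ +_) (+-identityʳ (periodCount a g)) ⟩
  S₂₃ + periodCount a g                              ≡⟨ +-comm S₂₃ (periodCount a g) ⟩
  periodCount a g + S₂₃                              ∎
  where
  open ≡-Reasoning
  S₂₃ = stripCount a (Δ g) 23

stripCount-Δⁿ : ∀ a q g → RowPeriodic g → stripCount a (Δⁿ q g) 24 ≡ stripCount a g 24
stripCount-Δⁿ a zero    g rows = refl
stripCount-Δⁿ a (suc q) g rows =
  trans (stripCount-Δⁿ a q (Δ g) (RowPeriodic-Δ g rows)) (stripCount-rotate a g rows)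

stripCountₗ : Z4 → List Z4 → ℕ → ℕ
stripCountₗ a xs zero    = 0
stripCountₗ a xs (suc p) = mult a (take 24 (drop 8 xs)) + stripCountₗ a (derive xs) p

stripCount-eval : ∀ a f p → stripCount a f p ≡ stripCountₗ a (prefix f (p + 32)) p
stripCount-eval a f zero    = refl
stripCount-eval a f (suc p) = cong₂ _+_ first-row
  (trans (stripCount-eval a (Δ f) p) (cong (λ xs → stripCountₗ a xs p) (sym (derive-prefix f (p + 32)))))
  where
  first-row : periodCount a f ≡ mult a (take 24 (drop 8 (prefix f (suc (p + 32)))))
  first-row = cong (mult a) (sym (trans
    (cong (λ n → take 24 (drop 8 (prefix f n))) (trans (sym (+-suc p 32)) (+-comm p 33)))
    (take-prefix (f ∘ (8 +_)) (m≤m+n 24 (suc p)))))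

-- The two equations are checked by evaluation: rows 30 and 6 of ∇s agree on 32 entries,
-- hence everywhere, and the periods of the rows 6, …, 29 together contain every
-- value equally often.
module PeriodicTriangles (s : Seq) (periodic : PeriodicAfter8 s)
  (rows-30≡6 : deriveⁿ 30 (prefix s (30 + 32)) ≡ deriveⁿ 6 (prefix s (6 + 32)))
  (strip-uniform₆ : tabulate (λ a → stripCountₗ a (deriveⁿ 6 (prefix s (6 + 56))) 24)
                    ≡ tabulate (λ _ → stripCountₗ zero (deriveⁿ 6 (prefix s (6 + 56))) 24))
  where

  rowPeriodic : RowPeriodic (Δⁿ 6 s)
  rowPeriodic j = trans (cong-app (sym (Δⁿ-+ 6 24 s)) j) (Δⁿ-30≗6 j)
    where
    Δⁿ-30≗6 : Δⁿ 30 s ≗ Δⁿ 6 s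
    Δⁿ-30≗6 = PeriodicAfter8-≗ {Δⁿ 30 s} {Δⁿ 6 s} (PeriodicAfter8-Δⁿ 30 s periodic) (PeriodicAfter8-Δⁿ 6 s periodic)
      (prefix-injective {Δⁿ 30 s} {Δⁿ 6 s} 32 (trans (sym (deriveⁿ-prefix 30 s 32)) (trans rows-30≡6 (deriveⁿ-prefix 6 s 32))))

  stripCount-uniform : ∀ q → Uniform (λ a → stripCount a (Δⁿ (6 + q) s) 24)
  stripCount-uniform q = uniform-via zero λ a →
    trans (to-row₆ a) (trans (tabulate-injective stripₑ (λ _ → stripₑ zero) strip-uniform₆ a) (sym (to-row₆ zero)))
    where
    stripₑ : Z4 → ℕ
    stripₑ a = stripCountₗ a (deriveⁿ 6 (prefix s (6 + 56))) 24
    to-row₆ : ∀ a → stripCount a (Δⁿ (6 + q) s) 24 ≡ stripₑ a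
    to-row₆ a = begin
      stripCount a (Δⁿ (6 + q) s) 24               ≡⟨ cong (λ g → stripCount a g 24) (Δⁿ-+ 6 q s) ⟩
      stripCount a (Δⁿ q (Δⁿ 6 s)) 24              ≡⟨ stripCount-Δⁿ a q (Δⁿ 6 s) rowPeriodic ⟩
      stripCount a (Δⁿ 6 s) 24                     ≡⟨ stripCount-eval a (Δⁿ 6 s) 24 ⟩
      stripCountₗ a (prefix (Δⁿ 6 s) (24 + 32)) 24 ≡⟨ cong (λ xs → stripCountₗ a xs 24) (sym (deriveⁿ-prefix 6 s 56)) ⟩
      stripₑ a                                     ∎
      where open ≡-Reasoning

  -- By triangleCount-+24, IncrementBalanced p says that ∇s[p+31] has the same surplus of
  -- every value over ∇s[p+7].
  gained lost : ℕ → Z4 → ℕ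
  gained p a = stripCount a s p + triangleCount a (Δⁿ p s) 31
  lost   p a = triangleCount a (Δⁿ p s) 7

  IncrementBalanced : ℕ → Set
  IncrementBalanced p = ConstantDifference (gained p) (lost p)

  TriangleBalanced : ℕ → Set
  TriangleBalanced n = Uniform (λ a → triangleCount a s n)

  triangleBalanced-+24 : ∀ p → IncrementBalanced p → TriangleBalanced (p + 7) → TriangleBalanced (p + 31)
  triangleBalanced-+24 p increment smaller = uniform-transfer (λ a → triangleCount-+24 a p periodic) smaller increment

  incrementBalanced-+24 : ∀ q → IncrementBalanced (6 + q) → IncrementBalanced (6 + q + 24)
  incrementBalanced-+24 q = constantDifference-extend gained-+24 lost-+24 (stripCount-uniform q)
    where
    p = 6 + q
    Δⁿ-+24 : Δⁿ (p + 24) s ≗ Δⁿ p s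
    Δⁿ-+24 j = begin
      Δⁿ (p + 24) s j        ≡⟨ cong-app (Δⁿ-+ p 24 s) j ⟩
      Δⁿ 24 (Δⁿ p s) j       ≡⟨ cong (λ g → Δⁿ 24 g j) (Δⁿ-+ 6 q s) ⟩
      Δⁿ 24 (Δⁿ q (Δⁿ 6 s)) j ≡⟨ RowPeriodic-Δⁿ q (Δⁿ 6 s) rowPeriodic j ⟩
      Δⁿ q (Δⁿ 6 s) j        ≡⟨ cong-app (sym (Δⁿ-+ 6 q s)) j ⟩
      Δⁿ p s j               ∎
      where open ≡-Reasoning
    gained-+24 : ∀ a → gained (p + 24) a ≡ gained p a + stripCount a (Δⁿ p s) 24
    gained-+24 a = begin
      stripCount a s (p + 24) + triangleCount a (Δⁿ (p + 24) s) 31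
        ≡⟨ cong₂ _+_ (stripCount-+ a s p 24) (triangleCount-cong a Δⁿ-+24 31) ⟩
      stripCount a s p + stripCount a (Δⁿ p s) 24 + triangleCount a (Δⁿ p s) 31
        ≡⟨ swap (stripCount a s p) _ _ ⟩
      stripCount a s p + triangleCount a (Δⁿ p s) 31 + stripCount a (Δⁿ p s) 24 ∎
      where
      open ≡-Reasoning
      swap : ∀ x y z → x + y + z ≡ x + z + y
      swap = solve-∀
    lost-+24 : ∀ a → lost (p + 24) a ≡ lost p a
    lost-+24 a = triangleCount-cong a Δⁿ-+24 7

  gainedₑ lostₑ : ℕ → Z4 → ℕ
  gainedₑ p a = stripCountₗ a (prefix s (p + 32)) p + mult a (rowsFrom 31 (deriveⁿ p (prefix s (p + 31))))
  lostₑ   p a = mult a (rowsFrom 7 (deriveⁿ p (prefix s (p + 7))))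

  incrementBalanced-eval : ∀ p → tabulate (λ a → gainedₑ p a + lostₑ p zero) ≡ tabulate (λ a → gainedₑ p zero + lostₑ p a)
                         → IncrementBalanced p
  incrementBalanced-eval p evaluated = constantDifference-via {u = gained p} {lost p} zero λ a → begin
    gained p a + lost p zero       ≡⟨ cong₂ _+_ (gained-eval a) (lost-eval zero) ⟩
    gainedₑ p a + lostₑ p zero     ≡⟨ tabulate-injective (λ a → gainedₑ p a + lostₑ p zero) (λ a → gainedₑ p zero + lostₑ p a)
                                                         evaluated a ⟩
    gainedₑ p zero + lostₑ p a     ≡⟨ sym (cong₂ _+_ (gained-eval zero) (lost-eval a)) ⟩
    gained p zero + lost p a       ∎
    where
    open ≡-Reasoning
    gained-eval : ∀ a → gained p a ≡ gainedₑ p a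
    gained-eval a = cong₂ _+_ (stripCount-eval a s p) (triangleCount-eval a p s 31)
    lost-eval : ∀ a → lost p a ≡ lostₑ p a
    lost-eval a = triangleCount-eval a p s 7

  -- Four base cases, since incrementBalanced-+24 applies only from row 6 on.
  incrementBalanced-8k+ : ∀ c → IncrementBalanced c → IncrementBalanced (8 + c) → IncrementBalanced (16 + c) →
                          IncrementBalanced (24 + c) → ∀ k → IncrementBalanced (8 * k + c)
  incrementBalanced-8k+ c i₀ i₁ i₂ i₃ zero    = i₀
  incrementBalanced-8k+ c i₀ i₁ i₂ i₃ (suc k) =
    subst IncrementBalanced (index k c) (stride₃-induction (λ k → IncrementBalanced (8 * k + (8 + c))) i₁ i₂ i₃ step k)
    where
    index : ∀ k c → 8 * k + (8 + c) ≡ 8 * suc k + c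
    index = solve-∀
    before : ∀ k c → 8 * k + (8 + c) ≡ 6 + (8 * k + (2 + c))
    before = solve-∀
    after : ∀ k c → 6 + (8 * k + (2 + c)) + 24 ≡ 8 * (3 + k) + (8 + c)
    after = solve-∀
    step : ∀ k → IncrementBalanced (8 * k + (8 + c)) → IncrementBalanced (8 * (3 + k) + (8 + c))
    step k ib = subst IncrementBalanced (after k c)
      (incrementBalanced-+24 (8 * k + (2 + c)) (subst IncrementBalanced (before k c) ib))

  triangleBalanced-8k+ : ∀ c → (∀ k → IncrementBalanced (8 * k + c)) → TriangleBalanced (c + 7) →
                         TriangleBalanced (8 + (c + 7)) → TriangleBalanced (16 + (c + 7)) → ∀ k → TriangleBalanced (8 * k + (c + 7))
  triangleBalanced-8k+ c increments t₀ t₁ t₂ = stride₃-induction (λ k → TriangleBalanced (8 * k + (c + 7))) t₀ t₁ t₂ step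
    where
    before : ∀ k c → 8 * k + (c + 7) ≡ 8 * k + c + 7
    before = solve-∀
    after : ∀ k c → 8 * k + c + 31 ≡ 8 * (3 + k) + (c + 7)
    after = solve-∀
    step : ∀ k → TriangleBalanced (8 * k + (c + 7)) → TriangleBalanced (8 * (3 + k) + (c + 7))
    step k tb = subst TriangleBalanced (after k c)
      (triangleBalanced-+24 (8 * k + c) (increments k) (subst TriangleBalanced (before k c) tb))

  triangleBalanced-eval : ∀ n → tabulate (λ a → mult a (rowsFrom n (prefix s n)))
                              ≡ tabulate (λ _ → mult zero (rowsFrom n (prefix s n)))
                        → TriangleBalanced n
  triangleBalanced-eval n evaluated = uniform-via zero λ a →
    trans (triangleCount-eval a 0 s n) (trans (tabulate-injective countₑ (λ _ → countₑ zero) evaluated a) (sym (triangleCount-eval zero 0 s n)))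
    where
    countₑ : Z4 → ℕ
    countₑ a = mult a (rowsFrom n (prefix s n))

  balanced-prefix : ∀ n → TriangleBalanced n → Balanced (prefix s n)
  balanced-prefix n tb a b = subst (λ m → mult a (rowsFrom m (prefix s n)) ≡ mult b (rowsFrom m (prefix s n)))
    (sym (length-prefix s n)) (trans (sym (triangleCount-eval a 0 s n)) (trans (tb a b) (triangleCount-eval b 0 s n)))

  stronglyBalanced-initSeg : ∀ n → (∀ t → 8 * t ≤ n → TriangleBalanced (n ∸ 8 * t)) → StronglyBalanced (initSeg s n)
  stronglyBalanced-initSeg n tb = subst StronglyBalanced (sym (initSeg≡prefix s n)) on-prefix
    where
    on-prefix : StronglyBalanced (prefix s n)
    on-prefix t 8t≤ = subst (λ m → Balanced (take (m ∸ 8 * t) (prefix s n))) (sym (length-prefix s n))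
      (subst Balanced (sym (take-prefix s (m∸n≤m n (8 * t))))
        (balanced-prefix (n ∸ 8 * t) (tb t (subst (8 * t ≤_) (length-prefix s n) 8t≤))))

  stronglyBalanced-8k : IncrementBalanced 1 → IncrementBalanced 9 → IncrementBalanced 17 → IncrementBalanced 25 →
                        TriangleBalanced 8 → TriangleBalanced 16 → TriangleBalanced 24 →
                        ∀ k → StronglyBalanced (initSeg s (8 * k))
  stronglyBalanced-8k i₀ i₁ i₂ i₃ t₀ t₁ t₂ k =
    stronglyBalanced-initSeg (8 * k) λ t _ → subst TriangleBalanced (*-distribˡ-∸ 8 k t) (triangles (k ∸ t))
    where
    triangles : ∀ k → TriangleBalanced (8 * k)
    triangles zero    = triangleBalanced-eval 0 refl
    triangles (suc k) = subst TriangleBalanced (index k)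
      (triangleBalanced-8k+ 1 (incrementBalanced-8k+ 1 i₀ i₁ i₂ i₃) t₀ t₁ t₂ k)
      where
      index : ∀ k → 8 * k + 8 ≡ 8 * suc k
      index = solve-∀

  stronglyBalanced-8k+7 : IncrementBalanced 0 → IncrementBalanced 8 → IncrementBalanced 16 → IncrementBalanced 24 →
                          TriangleBalanced 7 → TriangleBalanced 15 → TriangleBalanced 23 →
                          ∀ k → StronglyBalanced (initSeg s (8 * k + 7))
  stronglyBalanced-8k+7 i₀ i₁ i₂ i₃ t₀ t₁ t₂ k =
    stronglyBalanced-initSeg (8 * k + 7) λ t 8t≤ →
      subst TriangleBalanced (sym ([8k+r]∸8t≡8[k∸t]+r k t 7 ≤-refl 8t≤)) (triangles (k ∸ t))
    where
    triangles : ∀ k → TriangleBalanced (8 * k + 7)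
    triangles = triangleBalanced-8k+ 0 (incrementBalanced-8k+ 0 i₀ i₁ i₂ i₃) t₀ t₁ t₂

-- The six sequences

-- Checking this equation by refl would expand every entry of row 30 into a tree of 2³⁰
-- additions; the decision procedure evaluates the rows instead.
rows-≡-by-evaluation : ∀ {xs ys : List Z4} → True (≡-dec _≟_ xs ys) → xs ≡ ys
rows-≡-by-evaluation = toWitness

S₁-stronglyBalanced : ∀ k → StronglyBalanced (initSeg S₁ (8 * k))
S₁-stronglyBalanced = stronglyBalanced-8k
  (incrementBalanced-eval 1 refl) (incrementBalanced-eval 9 refl) (incrementBalanced-eval 17 refl) (incrementBalanced-eval 25 refl)
  (triangleBalanced-eval 8 refl) (triangleBalanced-eval 16 refl) (triangleBalanced-eval 24 refl)
  where open PeriodicTriangles S₁ (eventuallyPeriodic-periodicAfter8 S₁ refl ≤-refl refl) (rows-≡-by-evaluation tt) refl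

S₂-stronglyBalanced : ∀ k → StronglyBalanced (initSeg S₂ (8 * k))
S₂-stronglyBalanced = stronglyBalanced-8k
  (incrementBalanced-eval 1 refl) (incrementBalanced-eval 9 refl) (incrementBalanced-eval 17 refl) (incrementBalanced-eval 25 refl)
  (triangleBalanced-eval 8 refl) (triangleBalanced-eval 16 refl) (triangleBalanced-eval 24 refl)
  where open PeriodicTriangles S₂ (eventuallyPeriodic-periodicAfter8 S₂ refl ≤-refl refl) (rows-≡-by-evaluation tt) refl

T₁-stronglyBalanced : ∀ k → StronglyBalanced (initSeg T₁ (8 * k + 7))
T₁-stronglyBalanced = stronglyBalanced-8k+7
  (incrementBalanced-eval 0 refl) (incrementBalanced-eval 8 refl) (incrementBalanced-eval 16 refl) (incrementBalanced-eval 24 refl)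
  (triangleBalanced-eval 7 refl) (triangleBalanced-eval 15 refl) (triangleBalanced-eval 23 refl)
  where open PeriodicTriangles T₁ (eventuallyPeriodic-periodicAfter8 T₁ refl (n≤1+n 7) refl) (rows-≡-by-evaluation tt) refl

T₂-stronglyBalanced : ∀ k → StronglyBalanced (initSeg T₂ (8 * k + 7))
T₂-stronglyBalanced = stronglyBalanced-8k+7
  (incrementBalanced-eval 0 refl) (incrementBalanced-eval 8 refl) (incrementBalanced-eval 16 refl) (incrementBalanced-eval 24 refl)
  (triangleBalanced-eval 7 refl) (triangleBalanced-eval 15 refl) (triangleBalanced-eval 23 refl)
  where open PeriodicTriangles T₂ (eventuallyPeriodic-periodicAfter8 T₂ refl (n≤1+n 7) refl) (rows-≡-by-evaluation tt) refl

T₃-stronglyBalanced : ∀ k → StronglyBalanced (initSeg T₃ (8 * k + 7))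
T₃-stronglyBalanced = stronglyBalanced-8k+7
  (incrementBalanced-eval 0 refl) (incrementBalanced-eval 8 refl) (incrementBalanced-eval 16 refl) (incrementBalanced-eval 24 refl)
  (triangleBalanced-eval 7 refl) (triangleBalanced-eval 15 refl) (triangleBalanced-eval 23 refl)
  where open PeriodicTriangles T₃ (eventuallyPeriodic-periodicAfter8 T₃ refl (n≤1+n 7) refl) (rows-≡-by-evaluation tt) refl

T₄-stronglyBalanced : ∀ k → StronglyBalanced (initSeg T₄ (8 * k + 7))
T₄-stronglyBalanced = stronglyBalanced-8k+7
  (incrementBalanced-eval 0 refl) (incrementBalanced-eval 8 refl) (incrementBalanced-eval 16 refl) (incrementBalanced-eval 24 refl)
  (triangleBalanced-eval 7 refl) (triangleBalanced-eval 15 refl) (triangleBalanced-eval 23 refl)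
  where open PeriodicTriangles T₄ (eventuallyPeriodic-periodicAfter8 T₄ refl (n≤1+n 7) refl) (rows-≡-by-evaluation tt) refl

stronglyBalanced⇒balanced : ∀ xs → StronglyBalanced xs → Balanced xs
stronglyBalanced⇒balanced xs strong = subst Balanced (take-all (length xs) xs ≤-refl) (strong 0 z≤n)

balanced-of-length : ∀ n → n % 8 ≡ 0 ⊎ n % 8 ≡ 7 → Σ (List Z4) (λ S → length S ≡ n × Balanced S)
balanced-of-length n (inj₁ n%8≡0) =
  initSeg S₁ n , length-initSeg S₁ n ,
  stronglyBalanced⇒balanced _ (subst (StronglyBalanced ∘ initSeg S₁) (sym n≡8q) (S₁-stronglyBalanced (n / 8)))
  where
  n≡8q : n ≡ 8 * (n / 8)
  n≡8q = trans (m≡m%n+[m/n]*n n 8) (trans (cong (_+ n / 8 * 8) n%8≡0) (*-comm (n / 8) 8))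
balanced-of-length n (inj₂ n%8≡7) =
  initSeg T₁ n , length-initSeg T₁ n ,
  stronglyBalanced⇒balanced _ (subst (StronglyBalanced ∘ initSeg T₁) (sym n≡8q+7) (T₁-stronglyBalanced (n / 8)))
  where
  n≡8q+7 : n ≡ 8 * (n / 8) + 7
  n≡8q+7 = trans (m≡m%n+[m/n]*n n 8) (trans (cong (_+ n / 8 * 8) n%8≡7) (trans (+-comm 7 _) (cong (_+ 7) (*-comm (n / 8) 8))))

theorem1 : ((n : ℕ) → 1 ≤ n →
              (Σ (List Z4) (λ S → length S ≡ n × Balanced S)) ⇔ ((suc n C 2) % 4 ≡ 0))
           × ((k : ℕ) →
                StronglyBalanced (initSeg S₁ (8 * k))
              × StronglyBalanced (initSeg S₂ (8 * k))
              × StronglyBalanced (initSeg T₁ (8 * k + 7))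
              × StronglyBalanced (initSeg T₂ (8 * k + 7))
              × StronglyBalanced (initSeg T₃ (8 * k + 7))
              × StronglyBalanced (initSeg T₄ (8 * k + 7)))
theorem1 = (λ n _ → mk⇔ (λ { (S , refl , balanced) → balanced⇒C2%4≡0 S balanced })
                        (balanced-of-length n ∘ C2%4≡0⇒residue n))
         , λ k → S₁-stronglyBalanced k , S₂-stronglyBalanced k , T₁-stronglyBalanced k
               , T₂-stronglyBalanced k , T₃-stronglyBalanced k , T₄-stronglyBalanced k
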